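{- Let $F(X)$ be a CNF formula, $C$ a clause of $F$, and $q$ a partial assignment to $X$ that does not satisfy $C$. Let $P$ be a set of clauses each implied by $F$. Suppose that for every clause $C'$ of the $C$-cluster of $F$ that is not satisfied by $q$, and for every literal $l$ of $C'$ that is also a literal of $C$ and whose variable is unassigned by $q$, the set $P$ contains a clause that is an $l$-certificate for $C'$ in subspace $q$. Then $F$ is unsatisfiable in subspace $q$, i.e. no full assignment to $X$ extending $q$ satisfies $F$.
   Context: A CNF formula is viewed as a set of clauses. The $C$-cluster of $F$ is the set of clauses of $F$ consisting of $C$ together with every clause of $F$ that shares at least one literal (same variable, same sign) with $C$. For a clause $C'$ not satisfied by $q$ and a literal $l$ of $C'$ whose variable is unassigned by $q$, let $q_l$ be the shortest assignment satisfying $l$ and falsifying all other literals of $C'$; a clause $B$ is an $l$-certificate for $C'$ in subspace $q$ if $F$ implies $B$ and $B$ is falsified by the combined assignment $q \cup q_l$. -}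

module Defs where

open import Data.Nat using (ℕ)
open import Data.Fin using (Fin; _≟_)
open import Data.Bool using (Bool; true; false; not; if_then_else_)
open import Data.Bool.Properties renaming (_≟_ to _≟B_)
open import Data.Maybe using (Maybe; just; nothing)
open import Data.Product using (_×_; _,_; proj₁; proj₂; ∃-syntax)
open import Data.Product.Properties using (≡-dec)
open import Data.Sum using (_⊎_)
open import Data.List using (List; []; _∷_; filter)
open import Data.List.Membership.Propositional using (_∈_)
open import Data.List.Relation.Unary.All using (All)
open import Data.List.Relation.Unary.Any using (Any)
open import Relation.Binary.PropositionalEquality using (_≡_)
open import Relation.Nullary using (¬_; yes; no; ¬?; does)
open import Relation.Binary using (DecidableEquality)

-- Variables X = Fin n.  A literal is (variable , sign); sign true = positive literal.
Literal : ℕ → Set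
Literal n = Fin n × Bool

var : ∀ {n} → Literal n → Fin n
var = proj₁

sign : ∀ {n} → Literal n → Bool
sign = proj₂

_≟L_ : ∀ {n} → DecidableEquality (Literal n)
_≟L_ = ≡-dec _≟_ _≟B_

Clause : ℕ → Set
Clause n = List (Literal n)

CNF : ℕ → Set
CNF n = List (Clause n)

Assignment : ℕ → Set
Assignment n = Fin n → Bool

PAssign : ℕ → Set
PAssign n = Fin n → Maybe Bool

SatLit : ∀ {n} → Assignment n → Literal n → Set
SatLit s l = s (var l) ≡ sign l

SatClause : ∀ {n} → Assignment n → Clause n → Set
SatClause s C = Any (SatLit s) C

SatCNF : ∀ {n} → Assignment n → CNF n → Set
SatCNF s F = All (SatClause s) F

Implies : ∀ {n} → CNF n → Clause n → Set
Implies F B = ∀ s → SatCNF s F → SatClause s B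

PSatLit : ∀ {n} → PAssign n → Literal n → Set
PSatLit q l = q (var l) ≡ just (sign l)

PFalsLit : ∀ {n} → PAssign n → Literal n → Set
PFalsLit q l = q (var l) ≡ just (not (sign l))

PSatClause : ∀ {n} → PAssign n → Clause n → Set
PSatClause q C = Any (PSatLit q) C

PFalsClause : ∀ {n} → PAssign n → Clause n → Set
PFalsClause q B = All (PFalsLit q) B

Unassigned : ∀ {n} → PAssign n → Fin n → Set
Unassigned q v = q v ≡ nothing

Extends : ∀ {n} → Assignment n → PAssign n → Set
Extends s q = ∀ v b → q v ≡ just b → s v ≡ b

-- union of partial assignments (q takes priority on overlap)
_∪_ : ∀ {n} → PAssign n → PAssign n → PAssign n
(q ∪ r) v with q v
... | just b  = just b
... | nothing = r v

-- assignment falsifying the given literals (first occurrence wins)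
falsifyAll : ∀ {n} → Clause n → PAssign n
falsifyAll [] v = nothing
falsifyAll (m ∷ ms) v = if does (var m ≟ v) then just (not (sign m)) else falsifyAll ms v

-- q_l: shortest assignment satisfying l and falsifying all other literals of C'
q[_,_] : ∀ {n} → Literal n → Clause n → PAssign n
q[ l , C' ] v with v ≟ var l
... | yes _ = just (sign l)
... | no _  = falsifyAll (filter (λ m → ¬? (m ≟L l)) C') v

InCluster : ∀ {n} → CNF n → Clause n → Clause n → Set
InCluster F C C' = C' ∈ F × (C' ≡ C ⊎ Any (λ m → m ∈ C) C')

Certificate : ∀ {n} → CNF n → PAssign n → Clause n → Literal n → Clause n → Set
Certificate F q C' l B = Implies F B × PFalsClause (q ∪ q[ l , C' ]) B

UnsatIn : ∀ {n} → CNF n → PAssign n → Set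
UnsatIn F q = ∀ s → Extends s q → ¬ SatCNF s F

-- Suppose s extends q and satisfies F.  Walk s towards the assignment falsifyAll C,
-- which falsifies C as far as possible, by changing one variable of C at a time;
-- each changed variable carries a literal m of C that was true.  If some step breaks
-- a clause C' of F, then m was the only true literal of C', so C' lies in the C-cluster
-- and the assignment before the step extends q ∪ q_m; the m-certificate for C' is then
-- both satisfied and falsified.  If no step breaks F, the final model agrees with
-- falsifyAll C off the variable of any true literal l of C, and the l-certificate for C
-- gives the same contradiction.
module Submission where

open import Defs
open import Data.Nat using (ℕ)
open import Data.Fin using (Fin; _≟_)
open import Data.Bool.Properties using (not-¬; ¬-not; not-involutive) renaming (_≟_ to _≟B_)
open import Data.Maybe using (just; nothing)
open import Data.Maybe.Properties using (just-injective)
open import Data.Product using (_×_; _,_; ∃-syntax)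
open import Data.Sum using (_⊎_; inj₁; inj₂)
open import Data.Empty using (⊥)
open import Data.List using (List; []; _∷_; filter; allFin)
open import Data.List.Membership.Propositional using (_∈_; _∉_; find; lose)
open import Data.List.Membership.Propositional.Properties using (∈-allFin)
open import Data.List.Relation.Unary.All as All using (All; []; _∷_; all?)
open import Data.List.Relation.Unary.All.Properties using (All¬⇒¬Any; ¬Any⇒All¬; ¬All⇒Any¬)
open import Data.List.Relation.Unary.Any as Any using (here; there; any?)
open import Data.Vec.Functional using (updateAt)
open import Data.Vec.Functional.Properties using (updateAt-updates; updateAt-minimal)
open import Function using (_∘_)
open import Relation.Binary.PropositionalEquality using (_≡_; _≢_; refl; sym; trans; cong)
open import Relation.Nullary using (¬_; Dec; yes; no; ¬?; contradiction)

private
  variable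
    n : ℕ
    s : Assignment n
    q r : PAssign n
    l : Literal n
    C : Clause n

Agrees : Assignment n → PAssign n → Fin n → Set
Agrees s r v = ∀ b → r v ≡ just b → s v ≡ b

agrees-or-disagrees : (s : Assignment n) (r : PAssign n) (v : Fin n) →
  Agrees s r v ⊎ ∃[ b ] (r v ≡ just b × s v ≢ b)
agrees-or-disagrees s r v with r v
... | nothing = inj₁ λ _ ()
... | just b with s v ≟B b
...   | yes sv≡b = inj₁ λ { _ refl → sv≡b }
...   | no sv≢b = inj₂ (b , refl , sv≢b)

∉-∷⁻ : ∀ {P : Fin n → Set} {w vs} → P w →
  (∀ v → v ∉ w ∷ vs → P v) → ∀ v → v ∉ vs → P v
∉-∷⁻ {w = w} Pw P v v∉vs with v ≟ w
... | yes refl = Pw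
... | no v≢w = P v λ { (here v≡w) → v≢w v≡w ; (there v∈vs) → v∉vs v∈vs }

satClause? : (s : Assignment n) (C : Clause n) → Dec (SatClause s C)
satClause? s = any? (λ l → s (var l) ≟B sign l)

sat-lit-unique : ∀ {m : Literal n} → var l ≡ var m → SatLit s l → SatLit s m → l ≡ m
sat-lit-unique {l = v , _} refl sl sm = cong (v ,_) (trans (sym sl) sm)

extends⇒¬sat-falsified : Extends s r → PFalsClause r C → ¬ SatClause s C
extends⇒¬sat-falsified ext falsified =
  All¬⇒¬Any (All.map (λ {l} f sl → not-¬ sl (ext (var l) _ f)) falsified)

extends⇒sat : Extends s q → PSatClause q C → SatClause s C
extends⇒sat ext = Any.map (λ {l} ql → ext (var l) (sign l) ql)

extends-∪ : Extends s q → Extends s r → Extends s (q ∪ r)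
extends-∪ {q = q} extq extr v b qrv with q v in qv
... | just c = trans (extq v c qv) (just-injective qrv)
... | nothing = extr v b qrv

extends-updateAt : ∀ {w f} → Extends s q → Unassigned q w → Extends (updateAt s w f) q
extends-updateAt {s = s} {w = w} ext qw v b qv with v ≟ w
... | yes refl with () ← trans (sym qw) qv
... | no v≢w = trans (updateAt-minimal v w s v≢w) (ext v b qv)

sat-lit-unassigned : Extends s q → ¬ PSatClause q C → l ∈ C → SatLit s l → Unassigned q (var l)
sat-lit-unassigned {q = q} {l = l} ext ¬qC l∈C sl with q (var l) in ql
... | nothing = refl
... | just b = contradiction (lose l∈C (trans ql (cong just (trans (sym (ext _ b ql)) sl)))) ¬qC

falsifyAll-disagreement : ∀ {v b} → falsifyAll C v ≡ just b → s v ≢ b →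
  ∃[ m ] (m ∈ C × var m ≡ v × SatLit s m)
falsifyAll-disagreement {C = m ∷ C} {v = v} eq sv≢b with var m ≟ v
... | yes refl = m , here refl , refl ,
      trans (¬-not (sv≢b ∘ (λ e → trans e (just-injective eq)))) (not-involutive _)
... | no _ with falsifyAll-disagreement {C = C} eq sv≢b
...   | k , k∈C , e , sk = k , there k∈C , e , sk

extends-falsifyAll : All (λ l → ¬ SatLit s l) C → Extends s (falsifyAll C)
extends-falsifyAll {C = m ∷ C} (¬sm ∷ ¬sC) v b eq with var m ≟ v
... | yes refl = trans (¬-not ¬sm) (just-injective eq)
... | no _ = extends-falsifyAll ¬sC v b eq

falsifyAll-filter : ∀ (C : Clause n) {v} → v ≢ var l →
  falsifyAll (filter (λ m → ¬? (m ≟L l)) C) v ≡ falsifyAll C v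
falsifyAll-filter [] v≢l = refl
falsifyAll-filter {l = l} (m ∷ C) {v} v≢l with m ≟L l
... | yes refl with var m ≟ v
...   | yes refl = contradiction refl v≢l
...   | no _ = falsifyAll-filter C v≢l
falsifyAll-filter (m ∷ C) {v} v≢l | no _ with var m ≟ v
...   | yes _ = refl
...   | no _ = falsifyAll-filter C v≢l

extends-q[] : SatLit s l → (∀ v → v ≢ var l → Agrees s (falsifyAll C) v) → Extends s q[ l , C ]
extends-q[] {l = l} {C = C} sl agree v b eq with v ≟ var l
... | yes refl = trans sl (just-injective eq)
... | no v≢l = agree v v≢l b (trans (sym (falsifyAll-filter C v≢l)) eq)

updateAt-breaks : ∀ {w f} → SatClause s C → ¬ SatClause (updateAt s w f) C →
  ∃[ k ] (k ∈ C × var k ≡ w × SatLit s k)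
updateAt-breaks {s = s} {w = w} satC ¬sat' with find satC
... | k , k∈C , sk with var k ≟ w
...   | yes kw = k , k∈C , kw , sk
...   | no k≢w = contradiction (lose k∈C (trans (updateAt-minimal (var k) w s k≢w) sk)) ¬sat'

module _ {F : CNF n} {C : Clause n} {q : PAssign n} {P : List (Clause n)}
  (C∈F : C ∈ F) (¬qC : ¬ PSatClause q C)
  (certified : ∀ C' → InCluster F C C' → ¬ PSatClause q C' →
    ∀ l → l ∈ C' → l ∈ C → Unassigned q (var l) →
    ∃[ B ] (B ∈ P × Certificate F q C' l B))
  where

  certificate-refutes : ∀ {s C' l} → SatCNF s F → Extends s q →
    InCluster F C C' → ¬ PSatClause q C' → l ∈ C' → l ∈ C → SatLit s l →
    (∀ v → v ≢ var l → Agrees s (falsifyAll C') v) → ⊥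
  certificate-refutes sat ext inC' ¬qC' l∈C' l∈C sl agree
    with certified _ inC' ¬qC' _ l∈C' l∈C (sat-lit-unassigned ext ¬qC l∈C sl)
  ... | _ , _ , F⇒B , falsified =
    extends⇒¬sat-falsified (extends-∪ ext (extends-q[] sl agree)) falsified (F⇒B _ sat)

  update-breaking-refutes : ∀ {s m C' f} → SatCNF s F → Extends s q → m ∈ C → SatLit s m →
    C' ∈ F → ¬ SatClause (updateAt s (var m) f) C' → ⊥
  update-breaking-refutes {s} {m} {C'} sat ext m∈C sm C'∈F ¬s'C'
    with updateAt-breaks (All.lookup sat C'∈F) ¬s'C'
  ... | k , k∈C' , km , sk with refl ← sat-lit-unique km sk sm =
    certificate-refutes sat ext (C'∈F , inj₂ (lose k∈C' m∈C)) ¬qC' k∈C' m∈C sm agree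
    where
    ¬qC' : ¬ PSatClause q C'
    ¬qC' = ¬s'C' ∘ extends⇒sat (extends-updateAt ext (sat-lit-unassigned ext ¬qC m∈C sm))
    agree : ∀ v → v ≢ var m → Agrees s (falsifyAll C') v
    agree v v≢m b φv = trans (sym (updateAt-minimal v (var m) s v≢m))
      (extends-falsifyAll (¬Any⇒All¬ C' ¬s'C') v b φv)

  no-model-agreeing-outside : ∀ vs s → Extends s q → SatCNF s F →
    (∀ v → v ∉ vs → Agrees s (falsifyAll C) v) → ⊥
  no-model-agreeing-outside [] s ext sat agree with find (All.lookup sat C∈F)
  ... | l , l∈C , sl =
    certificate-refutes sat ext (C∈F , inj₁ refl) ¬qC l∈C l∈C sl (λ v _ → agree v λ ())
  no-model-agreeing-outside (w ∷ vs) s ext sat agree with agrees-or-disagrees s (falsifyAll C) w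
  ... | inj₁ agree-w = no-model-agreeing-outside vs s ext sat (∉-∷⁻ agree-w agree)
  ... | inj₂ (b , φw , sw≢b) with falsifyAll-disagreement {C = C} {s = s} φw sw≢b
  ...   | m , m∈C , refl , sm with all? (satClause? (updateAt s (var m) (λ _ → b))) F
  ...     | yes sat' = no-model-agreeing-outside vs s' (extends-updateAt ext (sat-lit-unassigned ext ¬qC m∈C sm))
                         sat' (∉-∷⁻ agree'-m agree')
    where
    s' : Assignment _
    s' = updateAt s (var m) (λ _ → b)
    agree'-m : Agrees s' (falsifyAll C) (var m)
    agree'-m b' φm = trans (updateAt-updates (var m) s) (just-injective (trans (sym φw) φm))
    agree' : ∀ v → v ∉ var m ∷ vs → Agrees s' (falsifyAll C) v
    agree' v v∉ b' φv = trans (updateAt-minimal v (var m) s (v∉ ∘ here)) (agree v v∉ b' φv)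
  ...     | no ¬sat' with find (¬All⇒Any¬ (satClause? _) F ¬sat')
  ...       | C' , C'∈F , ¬s'C' = update-breaking-refutes sat ext m∈C sm C'∈F ¬s'C'

proposition8 : ∀ {n} (F : CNF n) (C : Clause n) (q : PAssign n) (P : List (Clause n)) →
    C ∈ F → ¬ PSatClause q C →
    (∀ B → B ∈ P → Implies F B) →
    (∀ C' → InCluster F C C' → ¬ PSatClause q C' →
    ∀ l → l ∈ C' → l ∈ C → Unassigned q (var l) →
    ∃[ B ] (B ∈ P × Certificate F q C' l B)) →
    UnsatIn F q
-- Certificates already contain F ⊨ B.
proposition8 {n} F C q P C∈F ¬qC _ certified s ext sat =
  no-model-agreeing-outside C∈F ¬qC certified (allFin n) s ext sat (λ v v∉ → contradiction (∈-allFin v) v∉)
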